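{- Let $(V,\chi)$ be a complete colored directed graph with loops, where $\chi\colon V^2\to C$ assigns loops colors different from those of non-loops. If $k\ge 2$, then $\chi_{\mathsf{WL}}^{\infty}\equiv\chi_{\mathcal{W}[k]}^{\infty}$.
   Context: For a coloring $\chi$ of $V^2$, $\overline{\chi}(v_1,\dots,v_m)=(\chi(v_1,v_2),\dots,\chi(v_{m-1},v_m))$. The $2$-dimensional Weisfeiler-Leman refinement is $\chi_{\mathsf{WL}}(u,v)=\{\!\{\overline\chi(u,w,v): w\in V\}\!\}$; for $k\ge2$ the $k$-walk refinement is $\chi_{\mathcal{W}[k]}(u,v)=\{\!\{\overline\chi(u,w_1,\dots,w_{k-1},v): w_i\in V\}\!\}$. For a refinement $r$, $\chi_r^m$ denotes $m$ applications, and the stable coloring $\chi_r^\infty$ is $\chi_r^m$ for the smallest $m$ with $\chi_r^m\equiv\chi_r^{m+1}$, where $\chi\equiv\chi'$ means the two colorings induce the same partition of $V^2$. -}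

module Defs where

open import Data.Nat using (ℕ; zero; suc; _≤_; _<_)
open import Data.Fin using (Fin)
open import Data.Empty using (⊥)
open import Data.Vec using (Vec; []; _∷_)
open import Data.Product using (Σ; _×_; ∃)
open import Function.Bundles using (_↔_; Inverse)
open import Relation.Binary.PropositionalEquality using (_≡_)

-- A coloring of V² (V = Fin n) is represented by the partition it induces:
-- ColRel n u v u' v'  means  χ(u,v) and χ(u',v') have the same color.
ColRel : ℕ → Set₁
ColRel n = Fin n → Fin n → Fin n → Fin n → Set

colRel : ∀ {n} {C : Set} → (Fin n → Fin n → C) → ColRel n
colRel χ u v u' v' = χ u v ≡ χ u' v'

barEq : ∀ {n j} → ColRel n → Fin n → Vec (Fin n) j → Fin n
      → Fin n → Vec (Fin n) j → Fin n → Set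
barEq R u []       v u' []         v' = R u v u' v'
barEq R u (w ∷ ws) v u' (w' ∷ ws') v' = R u w u' w' × barEq R w ws v w' ws' v'

-- Equality of the multisets {{ χ̄(u,w⃗,v) : w⃗ ∈ V^j }} and {{ χ̄(u',w⃗,v') : w⃗ ∈ V^j }}:
-- there is a bijection π of V^j matching the entries.
-- k-walk refinement with j = k - 1 intermediate vertices.
walkRef : ∀ {n} → (j : ℕ) → ColRel n → ColRel n
walkRef {n} j R u v u' v' =
  Σ (Vec (Fin n) j ↔ Vec (Fin n) j) λ π →
    ∀ ws → barEq R u ws v u' (Inverse.to π ws) v'

-- 2-dimensional WL refinement: multiset {{ (χ(u,w),χ(w,v)) : w ∈ V }}.
wlRef : ∀ {n} → ColRel n → ColRel n
wlRef {n} R u v u' v' =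
  Σ (Fin n ↔ Fin n) λ π →
    ∀ w → R u w u' (Inverse.to π w) × R w v (Inverse.to π w) v'

iter : ∀ {n} → (ColRel n → ColRel n) → ℕ → ColRel n → ColRel n
iter r zero    R = R
iter r (suc m) R = r (iter r m R)

_≋_ : ∀ {n} → ColRel n → ColRel n → Set
_≋_ {n} R S = ∀ (u v u' v' : Fin n) → (R u v u' v' → S u v u' v') × (S u v u' v' → R u v u' v')

-- m is the smallest number with χ_r^m ≡ χ_r^{m+1}; then χ_r^∞ = χ_r^m.
IsStabIndex : ∀ {n} → (ColRel n → ColRel n) → ColRel n → ℕ → Set
IsStabIndex r R m =
  (iter r m R ≋ iter r (suc m) R) ×
  (∀ m' → m' < m → (iter r m' R ≋ iter r (suc m') R) → ⊥)

module Submission where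

-- Every refinement considered here only refines: a matching of common neighbours or of walks
-- must send the last vertex v to v', because a loop colour can only be matched by a loop colour.
-- A WL-stable colouring is walk-stable, since a walk bijection can be assembled vertex by vertex
-- from WL bijections.  Conversely, a walk-stable bijection sends the walks u,w,v,…,v exactly to the
-- walks u',w',v',…,v', and restricting it to them gives a WL bijection.  So each stable colouring
-- is a fixed point below the initial colouring of the other refinement, hence below all its
-- iterates by monotonicity, and the two stable colourings coincide.

open import Defs
open import Data.Nat using (ℕ; zero; suc; _≤_; _∸_; s≤s; z≤n)
open import Data.Fin using (Fin)
open import Data.Fin.Properties using (_≟_)
open import Data.Vec using (Vec; []; _∷_; replicate; head)
open import Data.Product using (_×_; _,_; proj₁; proj₂)
open import Data.Empty using (⊥-elim)
open import Function using (id; _∘_)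
open import Function.Bundles using (_↔_; Inverse; mk↔ₛ′)
open import Function.Properties.Inverse using (↔-refl)
open import Relation.Binary.PropositionalEquality
  using (_≡_; refl; sym; cong; cong₂; subst; module ≡-Reasoning)
open import Relation.Nullary using (¬_; yes; no)

private variable
  n j : ℕ
  A B X Y : Set
  R S : ColRel n

open Inverse using (to; from; strictlyInverseˡ; strictlyInverseʳ)

∷-↔ : (π : A ↔ B) → (A → Vec A j ↔ Vec B j) → Vec A (suc j) ↔ Vec B (suc j)
∷-↔ {A = A} {B = B} {j = j} π σ = mk↔ₛ′ to′ from′ to∘from from∘to
  where
  to′ : Vec A (suc j) → Vec B (suc j)
  to′ (a ∷ as) = to π a ∷ to (σ a) as

  from′ : Vec B (suc j) → Vec A (suc j)
  from′ (b ∷ bs) = from π b ∷ from (σ (from π b)) bs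

  to∘from : ∀ bs → to′ (from′ bs) ≡ bs
  to∘from (b ∷ bs) = cong₂ _∷_ (strictlyInverseˡ π b) (strictlyInverseˡ (σ _) bs)

  from∘to : ∀ as → from′ (to′ as) ≡ as
  from∘to (a ∷ as) with from π (to π a) | strictlyInverseʳ π a
  ... | .a | refl = cong (a ∷_) (strictlyInverseʳ (σ a) as)

↔-restrict : (π : X ↔ Y) (e : A → X) (p : X → A) (e′ : B → Y) (p′ : Y → B)
  → (∀ a → p (e a) ≡ a) → (∀ b → p′ (e′ b) ≡ b)
  → (∀ a → to π (e a) ≡ e′ (p′ (to π (e a))))
  → (∀ b → from π (e′ b) ≡ e (p (from π (e′ b))))
  → A ↔ B
↔-restrict π e p e′ p′ p∘e p′∘e′ to-closed from-closed =
  mk↔ₛ′ (p′ ∘ to π ∘ e) (p ∘ from π ∘ e′) to∘from from∘to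
  where
  open ≡-Reasoning
  to∘from : ∀ b → p′ (to π (e (p (from π (e′ b))))) ≡ b
  to∘from b = begin
    p′ (to π (e (p (from π (e′ b))))) ≡⟨ cong (p′ ∘ to π) (sym (from-closed b)) ⟩
    p′ (to π (from π (e′ b)))         ≡⟨ cong p′ (strictlyInverseˡ π (e′ b)) ⟩
    p′ (e′ b)                         ≡⟨ p′∘e′ b ⟩
    b                                 ∎

  from∘to : ∀ a → p (from π (e′ (p′ (to π (e a))))) ≡ a
  from∘to a = begin
    p (from π (e′ (p′ (to π (e a))))) ≡⟨ cong (p ∘ from π) (sym (to-closed a)) ⟩
    p (from π (to π (e a)))           ≡⟨ cong p (strictlyInverseʳ π (e a)) ⟩
    p (e a)                           ≡⟨ p∘e a ⟩
    a                                 ∎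

infix 4 _⊑_
_⊑_ : ColRel n → ColRel n → Set
R ⊑ S = ∀ {u v u′ v′} → R u v u′ v′ → S u v u′ v′

⊑-antisym : R ⊑ S → S ⊑ R → R ≋ S
⊑-antisym R⊑S S⊑R _ _ _ _ = R⊑S , S⊑R

≋⇒⊑ : R ≋ S → R ⊑ S
≋⇒⊑ R≋S = proj₁ (R≋S _ _ _ _)

SeparatesLoops : ColRel n → Set
SeparatesLoops R = ∀ {a b a′ b′} → R a b a′ b′ → (a ≡ b → a′ ≡ b′) × (a′ ≡ b′ → a ≡ b)

separatesLoops-⊑ : R ⊑ S → SeparatesLoops S → SeparatesLoops R
separatesLoops-⊑ R⊑S sep = sep ∘ R⊑S

colRel-separatesLoops : {C : Set} {χ : Fin n → Fin n → C}
  → (∀ u v w → ¬ u ≡ v → ¬ χ u v ≡ χ w w) → SeparatesLoops (colRel χ)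
colRel-separatesLoops {χ = χ} loop-colours {a} {b} {a′} {b′} same = loop⇒loop , loop⇐loop
  where
  loop⇒loop : a ≡ b → a′ ≡ b′
  loop⇒loop refl with a′ ≟ b′
  ... | yes a′≡b′ = a′≡b′
  ... | no a′≢b′ = ⊥-elim (loop-colours a′ b′ a a′≢b′ (sym same))
  loop⇐loop : a′ ≡ b′ → a ≡ b
  loop⇐loop refl with a ≟ b
  ... | yes a≡b = a≡b
  ... | no a≢b = ⊥-elim (loop-colours a b a′ a≢b same)

barEq-mono : R ⊑ S → ∀ {u v u′ v′} (ws ws′ : Vec (Fin n) j)
  → barEq R u ws v u′ ws′ v′ → barEq S u ws v u′ ws′ v′
barEq-mono R⊑S []       []         r       = R⊑S r
barEq-mono R⊑S (_ ∷ ws) (_ ∷ ws′) (r , rs) = R⊑S r , barEq-mono R⊑S ws ws′ rs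

barEq-replicateˡ : SeparatesLoops R → ∀ j {w v x v′} (ys : Vec (Fin n) j)
  → barEq R w (replicate j v) v x ys v′ → ys ≡ replicate j v′ × R w v x v′
barEq-replicateˡ sep zero    []       r = refl , r
barEq-replicateˡ sep (suc j) (y ∷ ys) (r , rs) with barEq-replicateˡ sep j ys rs
... | ys≡ , vv~yv′ with proj₁ (sep vv~yv′) refl
... | refl = cong (y ∷_) ys≡ , r

barEq-replicateʳ : SeparatesLoops R → ∀ j {w v x v′} (ys : Vec (Fin n) j)
  → barEq R w ys v x (replicate j v′) v′ → ys ≡ replicate j v × R w v x v′
barEq-replicateʳ sep zero    []       r = refl , r
barEq-replicateʳ sep (suc j) (y ∷ ys) (r , rs) with barEq-replicateʳ sep j ys rs
... | ys≡ , yv~v′v′ with proj₂ (sep yv~v′v′) refl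
... | refl = cong (y ∷_) ys≡ , r

barEq-∷-replicateˡ : SeparatesLoops R → ∀ j {u w v u′ v′} (ys : Vec (Fin n) (suc j))
  → barEq R u (w ∷ replicate j v) v u′ ys v′
  → ys ≡ head ys ∷ replicate j v′ × R u w u′ (head ys) × R w v (head ys) v′
barEq-∷-replicateˡ sep j (y ∷ ys) (r , rs) with barEq-replicateˡ sep j ys rs
... | ys≡ , wv~yv′ = cong (y ∷_) ys≡ , r , wv~yv′

barEq-∷-replicateʳ : SeparatesLoops R → ∀ j {u v u′ x v′} (ys : Vec (Fin n) (suc j))
  → barEq R u ys v u′ (x ∷ replicate j v′) v′ → ys ≡ head ys ∷ replicate j v
barEq-∷-replicateʳ sep j (y ∷ ys) (_ , rs) = cong (y ∷_) (proj₁ (barEq-replicateʳ sep j ys rs))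

wlRef-⊑ : SeparatesLoops R → wlRef R ⊑ R
wlRef-⊑ {R = R} sep {u} {v} {u′} (π , match) =
  subst (R u v u′) (proj₁ (sep (proj₂ (match v))) refl) (proj₁ (match v))

walkRef-⊑ : ∀ j → SeparatesLoops R → walkRef j R ⊑ R
walkRef-⊑ j sep (π , match) = proj₂ (barEq-replicateˡ sep j _ (match (replicate j _)))

wlRef-mono : R ⊑ S → wlRef R ⊑ wlRef S
wlRef-mono R⊑S (π , match) = π , λ w → R⊑S (proj₁ (match w)) , R⊑S (proj₂ (match w))

walkRef-mono : ∀ j → R ⊑ S → walkRef j R ⊑ walkRef j S
walkRef-mono j R⊑S (π , match) = π , λ ws → barEq-mono R⊑S ws (to π ws) (match ws)

wl-stable⇒walk-stable : {R : ColRel n} → R ⊑ wlRef R → ∀ j → R ⊑ walkRef j R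
wl-stable⇒walk-stable stable zero    r = ↔-refl , λ { [] → r }
wl-stable⇒walk-stable {R = R} stable (suc j) {u} {v} {u′} {v′} r =
  ∷-↔ π (proj₁ ∘ tail-stable) , λ { (w ∷ ws) → proj₁ (match w) , proj₂ (tail-stable w) ws }
  where
  π = proj₁ (stable r)
  match = proj₂ (stable r)

  tail-stable : ∀ w → walkRef j R w v (to π w) v′
  tail-stable w = wl-stable⇒walk-stable stable j (proj₂ (match w))

walk-stable⇒wl-stable : {R : ColRel n} → SeparatesLoops R → ∀ i → R ⊑ walkRef (suc i) R → R ⊑ wlRef R
walk-stable⇒wl-stable {n} {R} sep i stable {u} {v} {u′} {v′} r =
  ↔-restrict π (lasso v) head (lasso v′) head (λ _ → refl) (λ _ → refl) (proj₁ ∘ shape) back-shape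
  , proj₂ ∘ shape
  where
  π = proj₁ (stable r)
  match = proj₂ (stable r)

  lasso : Fin n → Fin n → Vec (Fin n) (suc i)
  lasso z w = w ∷ replicate i z

  shape : ∀ w → to π (lasso v w) ≡ lasso v′ (head (to π (lasso v w)))
              × R u w u′ (head (to π (lasso v w))) × R w v (head (to π (lasso v w))) v′
  shape w = barEq-∷-replicateˡ sep i _ (match (lasso v w))

  back-shape : ∀ x → from π (lasso v′ x) ≡ lasso v (head (from π (lasso v′ x)))
  back-shape x = barEq-∷-replicateʳ sep i {u} {v} {u′} {x} {v′} _
    (subst (λ ys → barEq R u (from π (lasso v′ x)) v u′ ys v′)
           (strictlyInverseˡ π (lasso v′ x)) (match (from π (lasso v′ x))))

iter-⊑ : (r : ColRel n → ColRel n) → (∀ {R} → SeparatesLoops R → r R ⊑ R)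
  → SeparatesLoops R → ∀ m → iter r m R ⊑ R
iter-⊑ r shrinks sep zero    = id
iter-⊑ r shrinks sep (suc m) = previous ∘ shrinks (separatesLoops-⊑ previous sep)
  where
  previous = iter-⊑ r shrinks sep m

⊑-iter : (r : ColRel n → ColRel n) → (∀ {R S} → R ⊑ S → r R ⊑ r S)
  → S ⊑ r S → S ⊑ R → ∀ m → S ⊑ iter r m R
⊑-iter r mono stable S⊑R zero    = S⊑R
⊑-iter r mono stable S⊑R (suc m) = mono (⊑-iter r mono stable S⊑R m) ∘ stable

lemma4 : (n : ℕ) (C : Set) (χ : Fin n → Fin n → C)
    → (∀ (u v w : Fin n) → ¬ (u ≡ v) → ¬ (χ u v ≡ χ w w))
    → (k : ℕ) → 2 ≤ k
    → (m₁ m₂ : ℕ)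
    → IsStabIndex wlRef (colRel χ) m₁
    → IsStabIndex (walkRef (k ∸ 1)) (colRel χ) m₂
    → iter wlRef m₁ (colRel χ) ≋ iter (walkRef (k ∸ 1)) m₂ (colRel χ)
lemma4 n C χ loop-colours (suc (suc i)) (s≤s (s≤s z≤n)) m₁ m₂ (wl-stable , _) (walk-stable , _) =
  ⊑-antisym wl⊑walk walk⊑wl
  where
  sep = colRel-separatesLoops loop-colours
  wl = iter wlRef m₁ (colRel χ)
  walk = iter (walkRef (suc i)) m₂ (colRel χ)

  wl⊑χ : wl ⊑ colRel χ
  wl⊑χ = iter-⊑ wlRef wlRef-⊑ sep m₁

  walk⊑χ : walk ⊑ colRel χ
  walk⊑χ = iter-⊑ (walkRef (suc i)) (walkRef-⊑ (suc i)) sep m₂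

  wl⊑walk : wl ⊑ walk
  wl⊑walk = ⊑-iter (walkRef (suc i)) (walkRef-mono (suc i))
    (wl-stable⇒walk-stable (≋⇒⊑ wl-stable) (suc i)) wl⊑χ m₂

  walk⊑wl : walk ⊑ wl
  walk⊑wl = ⊑-iter wlRef wlRef-mono
    (walk-stable⇒wl-stable (separatesLoops-⊑ walk⊑χ sep) i (≋⇒⊑ walk-stable)) walk⊑χ m₁
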